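{- For every inconsistent base $\mathscr{B}$, every family $\mathfrak{R}_A=(\mathfrak{R}_a)_{a\in A}$ of $S5$-modal relations, and every formula $\phi$, we have $\Vdash_{\mathscr{B},\mathfrak{R}_A}\phi$.
   Context: Fix a countably infinite set of atomic formulae and a nonempty set $A$ of agents. Formulae: $\phi ::= p \mid \bot \mid \phi\to\phi \mid K_a\phi$ with $p$ atomic and $a\in A$. A base rule is written $p_1,\dots,p_n\Rightarrow p$, where $\{p_1,\dots,p_n\}$ is a finite (possibly empty) set of atoms and $p$ is an atom. A base is a countable set of base rules; $\Omega$ is the set of all bases. $\overline{\mathscr{B}}$ is the smallest set of atoms closed under the rules of $\mathscr{B}$. A base $\mathscr{B}$ is inconsistent iff every atom lies in $\overline{\mathscr{B}}$, and consistent otherwise. An $S5$-modal relation is a binary relation $\mathfrak{R}$ on $\Omega$ that is reflexive, transitive and Euclidean (if $\mathfrak{R}\mathscr{B}\mathscr{C}$ and $\mathfrak{R}\mathscr{B}\mathscr{D}$ then $\mathfrak{R}\mathscr{C}\mathscr{D}$) and satisfies, for all bases $\mathscr{B}$: (a) if $\mathscr{B}$ is inconsistent, there is an inconsistent $\mathscr{C}$ with $\mathfrak{R}\mathscr{B}\mathscr{C}$, and every $\mathscr{D}$ with $\mathfrak{R}\mathscr{B}\mathscr{D}$ is inconsistent; (b) if $\mathscr{B}$ is consistent, every $\mathscr{C}$ with $\mathfrak{R}\mathscr{B}\mathscr{C}$ is consistent; (c) for all $\mathscr{C}$, if $\mathfrak{R}\mathscr{B}\mathscr{C}$ then for every consistent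 $\mathscr{D}\supseteq\mathscr{B}$ there is $\mathscr{E}\supseteq\mathscr{C}$ with $\mathfrak{R}\mathscr{D}\mathscr{E}$; (d) for all consistent $\mathscr{C}$, if $\mathfrak{R}\mathscr{B}\mathscr{C}$ then for every $\mathscr{D}\subseteq\mathscr{B}$ there is $\mathscr{E}\subseteq\mathscr{C}$ with $\mathfrak{R}\mathscr{D}\mathscr{E}$. For a family $\mathfrak{R}_A=(\mathfrak{R}_a)_{a\in A}$ of $S5$-modal relations, validity at a base is defined inductively: $\Vdash_{\mathscr{B},\mathfrak{R}_A}p$ iff $p\in\overline{\mathscr{B}}$; $\Vdash_{\mathscr{B},\mathfrak{R}_A}\phi\to\psi$ iff $\phi\Vdash_{\mathscr{B},\mathfrak{R}_A}\psi$; $\Vdash_{\mathscr{B},\mathfrak{R}_A}\bot$ iff $\Vdash_{\mathscr{B},\mathfrak{R}_A}p$ for every atom $p$; $\Vdash_{\mathscr{B},\mathfrak{R}_A}K_a\phi$ iff $\Vdash_{\mathscr{C},\mathfrak{R}_A}\phi$ for all $\mathscr{C}$ with $\mathfrak{R}_a\mathscr{B}\mathscr{C}$; and for a nonempty set $\Gamma$ of formulae, $\Gamma\Vdash_{\mathscr{B},\mathfrak{R}_A}\phi$ iff for every $\mathscr{C}\supseteq\mathscr{B}$, if $\Vdash_{\mathscr{C},\mathfrak{R}_A}\psi$ for all $\psi\in\Gamma$ then $\Vdash_{\mathscr{C},\mathfrak{R}_A}\phi$. -}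

module Defs where

open import Data.Nat using (ℕ)
open import Level using (Lift; lift) renaming (suc to lsuc; zero to lzero)
open import Data.List using (List)
open import Data.List.Relation.Unary.All using (All)
open import Data.Product using (Σ; ∃; _×_)
open import Relation.Nullary using (¬_)

Atom : Set
Atom = ℕ

data Formula (A : Set) : Set where
  atom : Atom → Formula A
  ⊥f   : Formula A
  _⇒_  : Formula A → Formula A → Formula A
  K    : A → Formula A → Formula A

-- A base rule  p₁,…,pₙ ⇒ p  (finite premise set given as a list).
record Rule : Set where
  constructor _⇛_
  field
    premises   : List Atom
    conclusion : Atom

-- A base is a set of rules (every such set is countable, as rules form a
-- countable set).  Ω is the type of all bases.
Base : Set₁
Base = Rule → Set

Ω : Set₁
Ω = Base

_⊆B_ : Base → Base → Set
B ⊆B C = ∀ r → B r → C r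

data Closure (B : Base) : Atom → Set where
  by : ∀ (r : Rule) → B r → All (Closure B) (Rule.premises r) →
       Closure B (Rule.conclusion r)

Inconsistent : Base → Set
Inconsistent B = ∀ (p : Atom) → Closure B p

Consistent : Base → Set
Consistent B = ¬ Inconsistent B

record IsS5 (R : Base → Base → Set) : Set₁ where
  field
    refl'      : ∀ B → R B B
    trans'     : ∀ B C D → R B C → R C D → R B D
    euclid     : ∀ B C D → R B C → R B D → R C D
    incons-ex  : ∀ B → Inconsistent B → Σ Base (λ C → R B C × Inconsistent C)
    incons-all : ∀ B → Inconsistent B → ∀ D → R B D → Inconsistent D
    cons-all   : ∀ B → Consistent B → ∀ C → R B C → Consistent C
    up         : ∀ B C → R B C → ∀ D → Consistent D → B ⊆B D →
                 Σ Base (λ E → C ⊆B E × R D E)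
    down       : ∀ B C → Consistent C → R B C → ∀ D → D ⊆B B →
                 Σ Base (λ E → E ⊆B C × R D E)

⊩ : {A : Set} → (A → Base → Base → Set) → Base → Formula A → Set₁
⊩ R B (atom p) = Lift (lsuc lzero) (Closure B p)
⊩ R B ⊥f = ∀ (p : Atom) → ⊩ R B (atom p)
⊩ R B (φ ⇒ ψ) = ∀ (C : Base) → B ⊆B C → ⊩ R C φ → ⊩ R C ψ
⊩ R B (K a φ) = ∀ (C : Base) → R a B C → ⊩ R C φ

{-# OPTIONS --safe #-}
module Submission where

open import Defs
open import Level using (lift)
open import Data.List using (List; []; _∷_)
open import Data.List.Relation.Unary.All using (All; []; _∷_)

-- Induction on φ: inconsistency passes to every extension (closure is monotone
-- in the base) and along every R a (condition (a)), and at an inconsistent base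
-- every atom, hence ⊥, is valid.

mutual
  closure-mono : ∀ {B C} → B ⊆B C → ∀ {p} → Closure B p → Closure C p
  closure-mono B⊆C (by r Br premises) = by r (B⊆C r Br) (closure-all-mono B⊆C premises)

  closure-all-mono : ∀ {B C} → B ⊆B C → ∀ {ps : List Atom} →
                     All (Closure B) ps → All (Closure C) ps
  closure-all-mono B⊆C []       = []
  closure-all-mono B⊆C (p ∷ ps) = closure-mono B⊆C p ∷ closure-all-mono B⊆C ps

inconsistent-mono : ∀ {B C} → B ⊆B C → Inconsistent B → Inconsistent C
inconsistent-mono B⊆C incB p = closure-mono B⊆C (incB p)

inconsistent⇒⊩ : {A : Set} (R : A → Base → Base → Set) →
                 (∀ a {B C} → R a B C → Inconsistent B → Inconsistent C) →
                 ∀ {B} → Inconsistent B → (φ : Formula A) → ⊩ R B φ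
inconsistent⇒⊩ R R-pres incB (atom p) = lift (incB p)
inconsistent⇒⊩ R R-pres incB ⊥f       = λ p → lift (incB p)
inconsistent⇒⊩ R R-pres incB (φ ⇒ ψ)  =
  λ C B⊆C _ → inconsistent⇒⊩ R R-pres (inconsistent-mono B⊆C incB) ψ
inconsistent⇒⊩ R R-pres incB (K a φ)  =
  λ C BRC → inconsistent⇒⊩ R R-pres (R-pres a BRC incB) φ

lemma4p5 : (A : Set) → A → (R : A → Base → Base → Set) → (∀ a → IsS5 (R a)) →
    (B : Base) → Inconsistent B → (φ : Formula A) → ⊩ R B φ
lemma4p5 A _ R S5 B incB = inconsistent⇒⊩ R R-pres incB
  where
  R-pres : ∀ a {B C} → R a B C → Inconsistent B → Inconsistent C
  R-pres a {B} {C} BRC incB = IsS5.incons-all (S5 a) B incB C BRC
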